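{- Let $p$ be a prime with $p\equiv1\pmod4$. Then $$\left|\left\{1\le k\le\frac{p-1}{2}:\ \left\{k\cdot\left(\frac{p-1}{2}\right)!\right\}_p>\frac p2\right\}\right|=\frac{p-1}{4}.$$
   Context: For an integer $y$, $\{y\}_p$ denotes the unique integer $r\in\{0,\dots,p-1\}$ with $r\equiv y\pmod p$. -}

module Defs where

open import Data.Nat using (ℕ; suc; _*_; _∸_; _<_; _<?_; NonZero; _!)
open import Data.Nat.DivMod using (_/_; _%_)
open import Data.List using (List; length; filter; map; upTo)

range1 : ℕ → List ℕ
range1 n = map suc (upTo n)

residue : (p : ℕ) → .{{NonZero p}} → ℕ → ℕ
residue p y = y % p

-- number of k with 1 ≤ k ≤ (p-1)/2 such that {k · ((p-1)/2)!}_p > p/2,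
-- where "r > p/2" is expressed as p < 2 * r (exact over the rationals)
countLarge : (p : ℕ) → .{{NonZero p}} → ℕ
countLarge p = length (filter (λ k → p <? 2 * residue p (k * (((p ∸ 1) / 2) !))) (range1 ((p ∸ 1) / 2)))

-- Let p = 2n + 1 with n = 2k and put F = n!. Since (p − i)(p − i − 1) ≡ i(i + 1) (mod p), grouping the
-- factors of (p − 1)! = F · (p − 1)(p − 2)⋯(p − n) in pairs shows (p − 1)! ≡ F², so Wilson's theorem gives
-- F² ≡ −1 (mod p). Write r(a) for the residue of aF; then r(r(a)) = p − a. Hence the map sending
-- a ∈ {1, …, n} to the absolute least residue of aF is an involution of {1, …, n} without fixed points
-- which exchanges the a with r(a) > p/2 and those with r(a) < p/2, and exactly n/2 = k values of a have
-- r(a) > p/2. Wilson's theorem itself is proved by the same pairing, matching each of 2, …, p − 2 with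
-- its inverse, which differs from it because x² ≡ 1 forces x ≡ ±1.

module Submission where

open import Defs

open import Level using (0ℓ; _⊔_)
open import Data.Bool using (true; false; not; if_then_else_)
open import Data.Bool.Properties using (not-involutive; not-¬)
open import Data.Empty using (⊥-elim)
open import Data.List using (List; []; _∷_; _++_; length; filter; upTo; applyDownFrom)
open import Data.List.Properties using (length-map; length-upTo)
open import Data.List.Membership.Propositional using (_∈_)
open import Data.List.Membership.Propositional.Properties using (∈-∃++; ∈-map⁺; ∈-map⁻; ∈-upTo⁺; ∈-upTo⁻; ∈-applyDownFrom⁺; ∈-applyDownFrom⁻)
open import Data.List.Relation.Unary.Any using (here; there)
open import Data.List.Relation.Unary.All as All using (_∷_)
open import Data.List.Relation.Unary.AllPairs using (_∷_)
open import Data.List.Relation.Unary.Unique.Propositional using (Unique)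
open import Data.List.Relation.Unary.Unique.Propositional.Properties using (applyDownFrom⁺₁; map⁺; upTo⁺)
open import Data.List.Relation.Binary.Permutation.Propositional using (_↭_; ↭-refl; ↭-sym; ↭-trans; ↭-prep; ↭⇒↭ₛ)
open import Data.List.Relation.Binary.Permutation.Propositional.Properties using (shift; ∈-resp-↭; ↭-length; filter-↭)
open import Data.List.Relation.Binary.Permutation.Setoid.Properties using (Unique-resp-↭)
open import Data.Nat hiding (_⊔_)
open import Data.Nat.Properties
open import Data.Nat.DivMod using (m*n/n≡m; %-distribˡ-+; %-distribˡ-*; %-remove-+ʳ; [m+kn]%n≡m%n; m%n%n≡m%n; m<n⇒m%n≡m; m≡m%n+[m/n]*n; m%n<n; m%n≤n)
open import Data.Nat.Divisibility using (_∣_; divides; ∣⇒≤; ∣-refl; ∣-trans; n∣m*n; m%n≡0⇒n∣m; n∣m⇒m%n≡0)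
open import Data.Nat.ListAction using (product)
open import Data.Nat.ListAction.Properties using (product-↭)
open import Data.Nat.Primality using (Prime; euclidsLemma; prime⇒nonTrivial)
open import Data.Nat.Coprimality as Coprime using (prime⇒coprime; coprime-Bézout)
open import Data.Nat.GCD using (module Bézout)
open import Data.Nat.Tactic.RingSolver using (solve-∀)
open import Data.Product using (_×_; _,_; proj₂; ∃-syntax)
open import Data.Sum using (_⊎_; inj₁; inj₂; [_,_]′)
open import Function using (_∘_)
open import Relation.Binary.Bundles using (Setoid)
open import Relation.Binary.Core using (Rel)
open import Relation.Binary.Definitions using (Symmetric)
open import Relation.Binary.Structures using (IsEquivalence)
import Relation.Binary.Reasoning.Setoid as SetoidReasoning
open import Relation.Binary.PropositionalEquality
open import Relation.Nullary using (¬_; does; yes; no; contradiction)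
open import Relation.Nullary.Decidable using (dec-true; dec-false)
open import Relation.Unary using (Pred; Decidable)

module _ {a ℓ} {A : Set a} (Q : A → A → Set ℓ) where

  data PairedBy : List A → Set (a ⊔ ℓ) where
    []   : PairedBy []
    pair : ∀ {x y zs} → Q x y → PairedBy zs → PairedBy (x ∷ y ∷ zs)

  HasPartners : List A → Set (a ⊔ ℓ)
  HasPartners xs = ∀ {x} → x ∈ xs → ∃[ y ] y ∈ xs × y ≢ x × Q x y

  hasPartners-resp-↭ : ∀ {xs ys} → xs ↭ ys → HasPartners xs → HasPartners ys
  hasPartners-resp-↭ xs↭ys has x∈ys with has (∈-resp-↭ (↭-sym xs↭ys) x∈ys)
  ... | y , y∈xs , y≢x , qxy = y , ∈-resp-↭ xs↭ys y∈xs , y≢x , qxy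

  partner-of-head : ∀ {x xs} → HasPartners (x ∷ xs) → ∃[ y ] ∃[ zs ] Q x y × x ∷ xs ↭ x ∷ y ∷ zs
  partner-of-head has with has (here refl)
  ... | y , here refl , y≢x , _ = ⊥-elim (y≢x refl)
  ... | y , there y∈xs , _ , qxy with ∈-∃++ y∈xs
  ...   | us , vs , refl = y , us ++ vs , qxy , ↭-prep _ (shift y us vs)

  module _ (Q-sym : Symmetric Q) (Q-functional : ∀ {x y z} → Q x y → Q x z → y ≡ z) where

    hasPartners-dropPair : ∀ {x y zs} → Unique (x ∷ y ∷ zs) → Q x y →
                           HasPartners (x ∷ y ∷ zs) → HasPartners zs
    hasPartners-dropPair {x} {y} {zs} ((_ ∷ x∉zs) ∷ y∉zs ∷ _) qxy has {z} z∈zs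
      with has (there (there z∈zs))
    ... | .x , here refl , _ , qzx =
      ⊥-elim (All.lookup y∉zs (subst (_∈ zs) (Q-functional (Q-sym qzx) qxy) z∈zs) refl)
    ... | .y , there (here refl) , _ , qzy =
      ⊥-elim (All.lookup x∉zs (subst (_∈ zs) (Q-functional (Q-sym qzy) (Q-sym qxy)) z∈zs) refl)
    ... | w , there (there w∈zs) , w≢z , qzw = w , w∈zs , w≢z , qzw

    pairUp : ∀ {xs} → Unique xs → HasPartners xs → ∃[ ys ] xs ↭ ys × PairedBy ys
    pairUp {xs} = go xs ≤-refl
      where
      go : ∀ {n} xs → length xs ≤ n → Unique xs → HasPartners xs → ∃[ ys ] xs ↭ ys × PairedBy ys
      go [] _ _ _ = [] , ↭-refl , []
      go {suc n} (x ∷ xs) (s≤s |xs|≤n) u has with partner-of-head has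
      ... | y , zs , qxy , xs↭ with Unique-resp-↭ (setoid _) (↭⇒↭ₛ xs↭) u
      ...   | u′@(_ ∷ _ ∷ u-zs)
        with go zs |zs|≤n u-zs (hasPartners-dropPair u′ qxy (hasPartners-resp-↭ xs↭ has))
        where
        |zs|≤n : length zs ≤ n
        |zs|≤n = ≤-trans (n≤1+n _) (≤-pred (subst (_≤ suc n) (↭-length xs↭) (s≤s |xs|≤n)))
      ...     | ys , zs↭ys , paired = x ∷ y ∷ ys , ↭-trans xs↭ (↭-prep x (↭-prep y zs↭ys)) , pair qxy paired

module _ {a p ℓ} {A : Set a} {P : Pred A p} (P? : Decidable P) {Q : A → A → Set ℓ}
         (Q⇒exactlyOne : ∀ {x y} → Q x y → does (P? x) ≡ not (does (P? y))) where

  length-filter-pairedBy : ∀ {xs} → PairedBy Q xs → length (filter P? xs) * 2 ≡ length xs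
  length-filter-pairedBy [] = refl
  length-filter-pairedBy (pair {x} {y} qxy rest) with does (P? x) | Q⇒exactlyOne qxy
  ... | true  | x⊻y with does (P? y) | x⊻y
  ...   | false | _ = cong (suc ∘ suc) (length-filter-pairedBy rest)
  length-filter-pairedBy (pair {x} {y} qxy rest) | false | x⊻y with does (P? y) | x⊻y
  ...   | true  | _ = cong (suc ∘ suc) (length-filter-pairedBy rest)

reflectedFactorial : ℕ → ℕ → ℕ
reflectedFactorial q zero    = 1
reflectedFactorial q (suc m) = (q ∸ suc m) * reflectedFactorial q m

factorial-split : ∀ r m → r ! * reflectedFactorial (suc (r + m)) m ≡ (r + m) !
factorial-split r zero = trans (*-identityʳ (r !)) (cong _! (sym (+-identityʳ r)))
factorial-split r (suc m) rewrite +-suc r m = begin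
  r ! * ((suc (r + m) ∸ m) * reflectedFactorial (suc (suc r + m)) m)
    ≡⟨ cong (λ k → r ! * (k * reflectedFactorial (suc (suc r + m)) m)) (m+n∸n≡m (suc r) m) ⟩
  r ! * (suc r * reflectedFactorial (suc (suc r + m)) m)
    ≡⟨ ring (r !) (suc r) _ ⟩
  (suc r * r !) * reflectedFactorial (suc (suc r + m)) m
    ≡⟨ factorial-split (suc r) m ⟩
  (suc r + m) ! ∎
  where
  open ≡-Reasoning
  ring : ∀ x y z → x * (y * z) ≡ (y * x) * z
  ring = solve-∀

module Modulo (p : ℕ) .{{_ : NonZero p}} where

  infix 4 _≈_
  -- Opaque so that, for a modulus of the form suc q, x ≈ y does not reduce to a stuck mod-helper term
  -- that would block the inference of x and y.
  opaque
    _≈_ : Rel ℕ 0ℓ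
    x ≈ y = x % p ≡ y % p

    ≈-isEquivalence : IsEquivalence _≈_
    ≈-isEquivalence = record { refl = refl ; sym = sym ; trans = trans }

    +-cong : ∀ {x y u v} → x ≈ y → u ≈ v → x + u ≈ y + v
    +-cong {x} {y} {u} {v} x≈y u≈v = begin
      (x + u) % p               ≡⟨ %-distribˡ-+ x u p ⟩
      (x % p + u % p) % p       ≡⟨ cong₂ (λ a b → (a + b) % p) x≈y u≈v ⟩
      (y % p + v % p) % p       ≡⟨ %-distribˡ-+ y v p ⟨
      (y + v) % p               ∎
      where open ≡-Reasoning

    *-cong : ∀ {x y u v} → x ≈ y → u ≈ v → x * u ≈ y * v
    *-cong {x} {y} {u} {v} x≈y u≈v = begin
      (x * u) % p               ≡⟨ %-distribˡ-* x u p ⟩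
      (x % p * (u % p)) % p     ≡⟨ cong₂ (λ a b → (a * b) % p) x≈y u≈v ⟩
      (y % p * (v % p)) % p     ≡⟨ %-distribˡ-* y v p ⟨
      (y * v) % p               ∎
      where open ≡-Reasoning

    %-≈ : ∀ x → x % p ≈ x
    %-≈ x = m%n%n≡m%n x p

    +-multiple : ∀ x k → x + k * p ≈ x
    +-multiple x k = [m+kn]%n≡m%n x k p

    <-≈⇒≡ : ∀ {x y} → x < p → y < p → x ≈ y → x ≡ y
    <-≈⇒≡ x<p y<p x≈y = trans (sym (m<n⇒m%n≡m x<p)) (trans x≈y (m<n⇒m%n≡m y<p))

    ≈⇒∣∸ : ∀ {x y} → y ≤ x → x ≈ y → p ∣ x ∸ y
    ≈⇒∣∸ {x} {y} y≤x x≈y = divides (x / p ∸ y / p) (begin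
      x ∸ y                                       ≡⟨ cong₂ _∸_ (m≡m%n+[m/n]*n x p) (m≡m%n+[m/n]*n y p) ⟩
      (x % p + x / p * p) ∸ (y % p + y / p * p)   ≡⟨ cong (λ r → (r + x / p * p) ∸ (y % p + y / p * p)) x≈y ⟩
      (y % p + x / p * p) ∸ (y % p + y / p * p)   ≡⟨ [m+n]∸[m+o]≡n∸o (y % p) _ _ ⟩
      x / p * p ∸ y / p * p                       ≡⟨ *-distribʳ-∸ p (x / p) (y / p) ⟨
      (x / p ∸ y / p) * p                         ∎)
      where open ≡-Reasoning

    ∣∸⇒≈ : ∀ {x y} → y ≤ x → p ∣ x ∸ y → x ≈ y
    ∣∸⇒≈ {x} {y} y≤x p∣x∸y = trans (cong (_% p) (sym (m+[n∸m]≡n y≤x))) (%-remove-+ʳ y p∣x∸y)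

    ∣⇒≈0 : ∀ {x} → p ∣ x → x ≈ 0
    ∣⇒≈0 {x} p∣x = trans (n∣m⇒m%n≡0 x p p∣x) (sym (m<n⇒m%n≡m (>-nonZero⁻¹ p)))

    ≈0⇒∣ : ∀ {x} → x ≈ 0 → p ∣ x
    ≈0⇒∣ {x} x≈0 = m%n≡0⇒n∣m x p (trans x≈0 (m<n⇒m%n≡m (>-nonZero⁻¹ p)))

  ≈-setoid : Setoid 0ℓ 0ℓ
  ≈-setoid = record { isEquivalence = ≈-isEquivalence }

  open Setoid ≈-setoid public using ()
    renaming (refl to ≈-refl; reflexive to ≈-reflexive; sym to ≈-sym; trans to ≈-trans)
  module ≈-Reasoning = SetoidReasoning ≈-setoid

  nonZero<⇒∤ : ∀ {x} .{{_ : NonZero x}} → x < p → ¬ p ∣ x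
  nonZero<⇒∤ x<p p∣x = <⇒≱ x<p (∣⇒≤ p∣x)

  +-cancelˡ : ∀ z {x y} → z + x ≈ z + y → x ≈ y
  +-cancelˡ z {x} {y} = [ cancel , (λ x≤y → ≈-sym ∘ cancel x≤y ∘ ≈-sym) ]′ (≤-total y x)
    where
    cancel : ∀ {x y} → y ≤ x → z + x ≈ z + y → x ≈ y
    cancel {x} {y} y≤x z+x≈z+y =
      ∣∸⇒≈ y≤x (subst (p ∣_) ([m+n]∸[m+o]≡n∸o z x y) (≈⇒∣∸ (+-monoʳ-≤ z y≤x) z+x≈z+y))

  x+[p∸x]≈0 : ∀ {x} → x ≤ p → x + (p ∸ x) ≈ 0
  x+[p∸x]≈0 x≤p = ∣⇒≈0 (subst (p ∣_) (sym (m+[n∸m]≡n x≤p)) ∣-refl)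

  product-pairedBy : ∀ {ℓ} {Q : Rel ℕ ℓ} → (∀ {x y} → Q x y → x * y ≈ 1) →
                     ∀ {xs} → PairedBy Q xs → product xs ≈ 1
  product-pairedBy _ [] = ≈-refl
  product-pairedBy inverse (pair {x} {y} {zs} qxy paired) = begin
    x * (y * product zs)   ≡⟨ *-assoc x y (product zs) ⟨
    (x * y) * product zs   ≈⟨ *-cong (inverse qxy) (product-pairedBy inverse paired) ⟩
    1                      ∎
    where open ≈-Reasoning

  [p∸a]*[p∸b]≈a*b : ∀ {a b} → a ≤ p → b ≤ p → (p ∸ a) * (p ∸ b) ≈ a * b
  [p∸a]*[p∸b]≈a*b {a} {b} a≤p b≤p = begin
    x * y                                   ≈⟨ +-multiple (x * y) (a + b) ⟨
    x * y + (a + b) * p                     ≡⟨ cong (x * y +_) (*-distribʳ-+ p a b) ⟩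
    x * y + (a * p + b * p)                 ≡⟨ cong₂ (λ u v → x * y + (a * u + b * v)) (sym y+b≡p) (sym x+a≡p) ⟩
    x * y + (a * (y + b) + b * (x + a))     ≡⟨ ring x a y b ⟩
    a * b + (x + a) * (y + b)               ≡⟨ cong₂ (λ u v → a * b + u * v) x+a≡p y+b≡p ⟩
    a * b + p * p                           ≈⟨ +-multiple (a * b) p ⟩
    a * b                                   ∎
    where
    open ≈-Reasoning
    x = p ∸ a
    y = p ∸ b
    x+a≡p : x + a ≡ p
    x+a≡p = m∸n+n≡m a≤p
    y+b≡p : y + b ≡ p
    y+b≡p = m∸n+n≡m b≤p
    ring : ∀ x a y b → x * y + (a * (y + b) + b * (x + a)) ≡ a * b + (x + a) * (y + b)
    ring = solve-∀

  reflectedFactorial-even : ∀ j → j * 2 ≤ p → reflectedFactorial p (j * 2) ≈ (j * 2) !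
  reflectedFactorial-even zero _ = ≈-refl
  reflectedFactorial-even (suc j) 2+2j≤p = begin
    (p ∸ (2 + j * 2)) * ((p ∸ (1 + j * 2)) * reflectedFactorial p (j * 2))
      ≡⟨ *-assoc (p ∸ (2 + j * 2)) _ _ ⟨
    (p ∸ (2 + j * 2)) * (p ∸ (1 + j * 2)) * reflectedFactorial p (j * 2)
      ≈⟨ *-cong ([p∸a]*[p∸b]≈a*b 2+2j≤p 1+2j≤p) (reflectedFactorial-even j (≤-trans (n≤1+n _) 1+2j≤p)) ⟩
    (2 + j * 2) * (1 + j * 2) * (j * 2) !
      ≡⟨ *-assoc (2 + j * 2) (1 + j * 2) ((j * 2) !) ⟩
    (2 + j * 2) ! ∎
    where
    open ≈-Reasoning
    1+2j≤p : 1 + j * 2 ≤ p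
    1+2j≤p = ≤-trans (n≤1+n _) 2+2j≤p

module PrimeModulus {q} (isPrime : Prime (suc q)) where
  private
    p = suc q
  open Modulo p

  1<p : 1 < p
  1<p = nonTrivial⇒n>1 p {{prime⇒nonTrivial isPrime}}

  1≉0 : ¬ 1 ≈ 0
  1≉0 1≈0 with <-≈⇒≡ 1<p z<s 1≈0
  ... | ()

  inverse-exists : ∀ {a} → 0 < a → a < p → ∃[ b ] b < p × a * b ≈ 1
  inverse-exists {a@(suc _)} _ a<p with coprime-Bézout (Coprime.sym (prime⇒coprime isPrime a<p))
  ... | Bézout.+- x y 1+yp≡xa = x % p , m%n<n x p , (begin
    a * (x % p)    ≈⟨ *-cong (≈-refl {a}) (%-≈ x) ⟩
    a * x          ≡⟨ trans (*-comm a x) (sym 1+yp≡xa) ⟩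
    1 + y * p      ≈⟨ +-multiple 1 y ⟩
    1              ∎)
    where open ≈-Reasoning
  -- Here x a ≡ −1, so x (p − 1) inverts a.
  ... | Bézout.-+ x y 1+xa≡yp = (x * q) % p , m%n<n (x * q) p , +-cancelˡ (1 + x * a) (begin
    1 + x * a + a * ((x * q) % p)   ≈⟨ +-cong (≈-refl {1 + x * a}) (*-cong (≈-refl {a}) (%-≈ (x * q))) ⟩
    1 + x * a + a * (x * q)         ≡⟨ ring a x q ⟩
    1 + (x * a) * p                 ≈⟨ +-multiple 1 (x * a) ⟩
    1                               ≈⟨ +-multiple 1 y ⟨
    1 + y * p                       ≡⟨ trans (cong suc (sym 1+xa≡yp)) (+-comm 1 (1 + x * a)) ⟩
    1 + x * a + 1                   ∎)
    where
    open ≈-Reasoning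
    ring : ∀ a x q → 1 + x * a + a * (x * q) ≡ 1 + (x * a) * suc q
    ring = solve-∀

  square≈1⇒±1 : ∀ a → suc a * suc a ≈ 1 → p ∣ a ⊎ p ∣ suc (suc a)
  square≈1⇒±1 a a²≈1 =
    euclidsLemma a (suc (suc a)) isPrime (subst (p ∣_) (ring a) (≈⇒∣∸ (s≤s z≤n) a²≈1))
    where
    ring : ∀ a → a + a * suc a ≡ a * suc (suc a)
    ring = solve-∀

module Wilson (t : ℕ) (isPrime : Prime (3 + t)) where
  private
    p = 3 + t
  open Modulo p
  open PrimeModulus isPrime

  inner : List ℕ
  inner = applyDownFrom (2 +_) t

  product-inner : product inner ≡ (1 + t) !
  product-inner = go t
    where
    go : ∀ t → product (applyDownFrom (2 +_) t) ≡ (1 + t) !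
    go zero = refl
    go (suc t) = cong ((2 + t) *_) (go t)

  Inverse : Rel ℕ 0ℓ
  Inverse a b = a < p × b < p × a * b ≈ 1

  inverse-sym : Symmetric Inverse
  inverse-sym {a} {b} (a<p , b<p , ab≈1) = b<p , a<p , ≈-trans (≈-reflexive (*-comm b a)) ab≈1

  inverse-functional : ∀ {a b c} → Inverse a b → Inverse a c → b ≡ c
  inverse-functional {a} {b} {c} (_ , b<p , ab≈1) (_ , c<p , ac≈1) = <-≈⇒≡ b<p c<p (begin
    b              ≡⟨ *-identityʳ b ⟨
    b * 1          ≈⟨ *-cong (≈-refl {b}) ac≈1 ⟨
    b * (a * c)    ≡⟨ ring a b c ⟩
    (a * b) * c    ≈⟨ *-cong ab≈1 (≈-refl {c}) ⟩
    1 * c          ≡⟨ *-identityˡ c ⟩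
    c              ∎)
    where
    open ≈-Reasoning
    ring : ∀ a b c → b * (a * c) ≡ (a * b) * c
    ring = solve-∀

  3+i<p : ∀ {i} → i < t → 3 + i < p
  3+i<p i<t = s≤s (s≤s (s≤s i<t))

  2+i<p : ∀ {i} → i < t → 2 + i < p
  2+i<p i<t = <-trans (n<1+n _) (3+i<p i<t)

  inverse∈inner : ∀ {i b} → i < t → b < p → (2 + i) * b ≈ 1 → b ∈ inner
  inverse∈inner {i} {zero} _ _ a0≈1 = ⊥-elim (1≉0 (≈-trans (≈-sym a0≈1) (≈-reflexive (*-zeroʳ (2 + i)))))
  inverse∈inner {i} {suc zero} i<t _ a1≈1
    with <-≈⇒≡ (2+i<p i<t) 1<p (≈-trans (≈-reflexive (sym (*-identityʳ (2 + i)))) a1≈1)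
  ... | ()
  inverse∈inner {i} {suc (suc j)} i<t (s≤s (s≤s (s≤s j≤t))) ab≈1 with m≤n⇒m<n∨m≡n j≤t
  ... | inj₁ j<t = ∈-applyDownFrom⁺ (2 +_) j<t
  ... | inj₂ refl with <-≈⇒≡ (3+i<p i<t) z<s (begin
    3 + i                    ≈⟨ +-cong ab≈1 (≈-refl {2 + i}) ⟨
    (2 + i) * (2 + t) + (2 + i)  ≡⟨ ring (2 + i) t ⟩
    (2 + i) * p              ≈⟨ ∣⇒≈0 (n∣m*n (2 + i)) ⟩
    0                        ∎)
    where
    open ≈-Reasoning
    ring : ∀ a t → a * (2 + t) + a ≡ a * (3 + t)
    ring = solve-∀
  ... | ()

  not-self-inverse : ∀ {i} → i < t → ¬ (2 + i) * (2 + i) ≈ 1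
  not-self-inverse {i} i<t a²≈1 with square≈1⇒±1 (1 + i) a²≈1
  ... | inj₁ p∣1+i = nonZero<⇒∤ (<-trans (n<1+n _) (2+i<p i<t)) p∣1+i
  ... | inj₂ p∣3+i = nonZero<⇒∤ (3+i<p i<t) p∣3+i

  inner-hasPartners : HasPartners Inverse inner
  inner-hasPartners a∈inner with ∈-applyDownFrom⁻ (2 +_) a∈inner
  ... | i , i<t , refl with inverse-exists z<s (2+i<p i<t)
  ... | b , b<p , ab≈1 = b , inverse∈inner i<t b<p ab≈1 , b≢a , 2+i<p i<t , b<p , ab≈1
    where
    b≢a : b ≢ 2 + i
    b≢a refl = not-self-inverse i<t ab≈1

  p∣1+[p∸1]! : p ∣ suc ((2 + t) !)
  p∣1+[p∸1]! with pairUp Inverse inverse-sym inverse-functional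
                 (applyDownFrom⁺₁ (2 +_) t (λ j<i _ → <⇒≢ j<i ∘ sym ∘ suc-injective ∘ suc-injective))
                 inner-hasPartners
  ... | paired-inner , inner↭ , paired = ≈0⇒∣ (begin
    suc ((2 + t) * (1 + t) !)          ≡⟨ cong (λ m → suc ((2 + t) * m)) (trans (sym product-inner) (product-↭ inner↭)) ⟩
    suc ((2 + t) * product paired-inner)  ≈⟨ +-cong (≈-refl {1}) (*-cong (≈-refl {2 + t}) (product-pairedBy (proj₂ ∘ proj₂) paired)) ⟩
    suc ((2 + t) * 1)                  ≡⟨ cong suc (*-identityʳ (2 + t)) ⟩
    p                                  ≈⟨ ∣⇒≈0 ∣-refl ⟩
    0                                  ∎)
    where open ≈-Reasoning

wilson : ∀ q → Prime (suc q) → suc q ∣ suc (q !)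
wilson zero isPrime = contradiction refl (nonTrivial⇒≢1 {{prime⇒nonTrivial isPrime}})
wilson (suc zero) _ = ∣-refl
wilson (suc (suc t)) isPrime = Wilson.p∣1+[p∸1]! t isPrime

halfFactorial-square : ∀ n → 2 ∣ n → Prime (suc (n + n)) → suc (n + n) ∣ suc (n ! * n !)
halfFactorial-square n@.(j * 2) (divides j refl) isPrime = ≈0⇒∣ (begin
  suc (n ! * n !)                                ≈⟨ +-cong (≈-refl {1}) (*-cong (≈-refl {n !}) (reflectedFactorial-even j (≤-trans (m≤m+n n n) (n≤1+n _)))) ⟨
  suc (n ! * reflectedFactorial (suc (n + n)) n) ≡⟨ cong suc (factorial-split n n) ⟩
  suc ((n + n) !)                                ≈⟨ ∣⇒≈0 (wilson (n + n) isPrime) ⟩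
  0                                              ∎)
  where
  open Modulo (suc (n + n))
  open ≈-Reasoning

largeResidueCount : (p : ℕ) .{{_ : NonZero p}} → ℕ → ℕ → ℕ
largeResidueCount p F n = length (filter (λ a → p <? 2 * residue p (a * F)) (range1 n))

module LargeResidues (n F : ℕ) (p∣F²+1 : suc (n + n) ∣ suc (F * F)) where
  private
    p = suc (n + n)
  open Modulo p

  AboveHalf : ℕ → Set
  AboveHalf x = p < 2 * x

  ≤n⇒¬AboveHalf : ∀ {x} → x ≤ n → ¬ AboveHalf x
  ≤n⇒¬AboveHalf {x} x≤n p<2x =
    <⇒≱ p<2x (≤-trans (*-monoʳ-≤ 2 x≤n) (≤-trans (≤-reflexive (twice n)) (n≤1+n _)))
    where
    twice : ∀ m → 2 * m ≡ m + m
    twice m = cong (m +_) (+-identityʳ m)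

  n<⇒AboveHalf : ∀ {x} → n < x → AboveHalf x
  n<⇒AboveHalf {x} n<x = subst (_≤ 2 * x) (ring n) (*-monoʳ-≤ 2 n<x)
    where
    ring : ∀ n → 2 * suc n ≡ suc (suc (n + n))
    ring = solve-∀

  ¬AboveHalf⇒≤n : ∀ {x} → ¬ AboveHalf x → x ≤ n
  ¬AboveHalf⇒≤n ¬above = ≮⇒≥ (¬above ∘ n<⇒AboveHalf)

  ≤n⇒<p : ∀ {x} → x ≤ n → x < p
  ≤n⇒<p x≤n = s≤s (≤-trans x≤n (m≤m+n n n))

  AboveHalf⇒n< : ∀ {x} → AboveHalf x → n < x
  AboveHalf⇒n< above = ≰⇒> (λ x≤n → ≤n⇒¬AboveHalf x≤n above)

  r : ℕ → ℕ
  r a = residue p (a * F)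

  Large : ℕ → Set
  Large a = AboveHalf (r a)

  large? : Decidable Large
  large? a = p <? 2 * r a

  Large⇒0< : ∀ {a} → Large a → 0 < a
  Large⇒0< {suc _} _ = z<s

  a+a*F*F≈0 : ∀ a → a + a * F * F ≈ 0
  a+a*F*F≈0 a = ∣⇒≈0 (subst (p ∣_) (ring a F) (∣-trans p∣F²+1 (n∣m*n a)))
    where
    ring : ∀ a F → a * suc (F * F) ≡ a + a * F * F
    ring = solve-∀

  r[r[a]]≡p∸a : ∀ {a} → 0 < a → a < p → r (r a) ≡ p ∸ a
  r[r[a]]≡p∸a {a@(suc a-1)} _ a<p = <-≈⇒≡ (m%n<n (r a * F) p) (s≤s (m∸n≤m (n + n) a-1)) (+-cancelˡ a (begin
    a + r (r a)      ≈⟨ +-cong (≈-refl {a}) (%-≈ (r a * F)) ⟩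
    a + r a * F      ≈⟨ +-cong (≈-refl {a}) (*-cong (%-≈ (a * F)) (≈-refl {F})) ⟩
    a + a * F * F    ≈⟨ a+a*F*F≈0 a ⟩
    0                ≈⟨ x+[p∸x]≈0 (<⇒≤ a<p) ⟨
    a + (p ∸ a)      ∎))
    where open ≈-Reasoning

  r[p∸r[a]]≡a : ∀ {a} → a < p → r (p ∸ r a) ≡ a
  r[p∸r[a]]≡a {a} a<p = <-≈⇒≡ (m%n<n ((p ∸ r a) * F) p) a<p (+-cancelˡ (r a * F) (begin
    r a * F + r (p ∸ r a)          ≈⟨ +-cong (≈-refl {r a * F}) (%-≈ ((p ∸ r a) * F)) ⟩
    r a * F + (p ∸ r a) * F        ≡⟨ *-distribʳ-+ F (r a) (p ∸ r a) ⟨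
    (r a + (p ∸ r a)) * F          ≈⟨ *-cong (x+[p∸x]≈0 (m%n≤n (a * F) p)) (≈-refl {F}) ⟩
    0                              ≈⟨ a+a*F*F≈0 a ⟨
    a + a * F * F                  ≡⟨ +-comm a (a * F * F) ⟩
    a * F * F + a                  ≈⟨ +-cong (*-cong (%-≈ (a * F)) (≈-refl {F})) (≈-refl {a}) ⟨
    r a * F + a                    ∎))
    where open ≈-Reasoning

  partner : ℕ → ℕ
  partner a = if does (large? a) then p ∸ r a else r a

  partner-large : ∀ {a} → Large a → partner a ≡ p ∸ r a
  partner-large {a} large-a = cong (λ c → if c then p ∸ r a else r a) (dec-true (large? a) large-a)

  partner-small : ∀ {a} → ¬ Large a → partner a ≡ r a
  partner-small {a} small-a = cong (λ c → if c then p ∸ r a else r a) (dec-false (large? a) small-a)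

  Partners : Rel ℕ 0ℓ
  Partners a b = partner a ≡ b × partner b ≡ a × does (large? a) ≡ not (does (large? b))

  partners-sym : Symmetric Partners
  partners-sym {a} {b} (a↦b , b↦a , a⊻b) = b↦a , a↦b , sym (trans (cong not a⊻b) (not-involutive _))

  partners-functional : ∀ {a b c} → Partners a b → Partners a c → b ≡ c
  partners-functional (a↦b , _) (a↦c , _) = trans (sym a↦b) a↦c

  partner-of-large : ∀ {a} → a ≤ n → Large a →
                     let b = p ∸ r a in 0 < b × b ≤ n × Partners a b
  partner-of-large {a} a≤n large-a = m<n⇒0<n∸m ra<p , b≤n , partner-large {a} large-a , b↦a , a⊻b
    where
    ra<p : r a < p
    ra<p = m%n<n (a * F) p
    b≤n : p ∸ r a ≤ n
    b≤n = ≤-trans (∸-monoʳ-≤ {suc n} {r a} p (AboveHalf⇒n< {r a} large-a)) (≤-reflexive (m+n∸n≡m n n))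
    rb≡a : r (p ∸ r a) ≡ a
    rb≡a = r[p∸r[a]]≡a (≤n⇒<p a≤n)
    small-b : ¬ Large (p ∸ r a)
    small-b = ≤n⇒¬AboveHalf (subst (_≤ n) (sym rb≡a) a≤n)
    b↦a : partner (p ∸ r a) ≡ a
    b↦a = trans (partner-small {p ∸ r a} small-b) rb≡a
    a⊻b : does (large? a) ≡ not (does (large? (p ∸ r a)))
    a⊻b = trans (dec-true (large? a) large-a) (cong not (sym (dec-false (large? (p ∸ r a)) small-b)))

  partner-of-small : ∀ {a} → 0 < a → a ≤ n → ¬ Large a →
                     let b = r a in 0 < b × b ≤ n × Partners a b
  partner-of-small {a} 0<a a≤n small-a =
    Large⇒0< {r a} large-b , ¬AboveHalf⇒≤n {r a} small-a , partner-small {a} small-a , b↦a , a⊻b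
    where
    rb≡p∸a : r (r a) ≡ p ∸ a
    rb≡p∸a = r[r[a]]≡p∸a 0<a (≤n⇒<p a≤n)
    large-b : Large (r a)
    large-b = subst AboveHalf (sym rb≡p∸a)
      (n<⇒AboveHalf (≤-trans (≤-reflexive (sym (m+n∸n≡m (suc n) n))) (∸-monoʳ-≤ {a} {n} p a≤n)))
    b↦a : partner (r a) ≡ a
    b↦a = begin
      partner (r a)   ≡⟨ partner-large {r a} large-b ⟩
      p ∸ r (r a)     ≡⟨ cong (p ∸_) rb≡p∸a ⟩
      p ∸ (p ∸ a)     ≡⟨ m∸[m∸n]≡n (<⇒≤ (≤n⇒<p a≤n)) ⟩
      a               ∎
      where open ≡-Reasoning
    a⊻b : does (large? a) ≡ not (does (large? (r a)))
    a⊻b = trans (dec-false (large? a) small-a) (cong not (sym (dec-true (large? (r a)) large-b)))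

  partner-in-range : ∀ {a} → 0 < a → a ≤ n → ∃[ b ] 0 < b × b ≤ n × Partners a b
  partner-in-range {a} 0<a a≤n with large? a
  ... | yes large-a = p ∸ r a , partner-of-large a≤n large-a
  ... | no small-a  = r a , partner-of-small 0<a a≤n small-a

  range1-hasPartners : HasPartners Partners (range1 n)
  range1-hasPartners a∈range with ∈-map⁻ suc a∈range
  ... | i , i∈upTo , refl with partner-in-range z<s (∈-upTo⁻ i∈upTo)
  ...   | suc j , _ , b≤n , partners@(_ , _ , a⊻b) =
    suc j , ∈-map⁺ suc (∈-upTo⁺ b≤n) , (λ { refl → not-¬ refl a⊻b }) , partners

  largeResidueCount-half : largeResidueCount p F n * 2 ≡ n
  largeResidueCount-half with pairUp Partners partners-sym partners-functional
                                (map⁺ suc-injective (upTo⁺ n)) range1-hasPartners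
  ... | ys , range↭ys , paired = begin
    length (filter large? (range1 n)) * 2   ≡⟨ cong (_* 2) (↭-length (filter-↭ large? range↭ys)) ⟩
    length (filter large? ys) * 2           ≡⟨ length-filter-pairedBy large? (proj₂ ∘ proj₂) paired ⟩
    length ys                               ≡⟨ ↭-length range↭ys ⟨
    length (range1 n)                       ≡⟨ trans (length-map suc (upTo n)) (length-upTo n) ⟩
    n                                       ∎
    where open ≡-Reasoning

countLarge-4k+1 : ∀ k → Prime (suc (k * 2 + k * 2)) → countLarge (suc (k * 2 + k * 2)) ≡ k
countLarge-4k+1 k isPrime = begin
  countLarge p                  ≡⟨ cong (λ h → largeResidueCount p (h !) h) (half n) ⟩
  largeResidueCount p (n !) n   ≡⟨ *-cancelʳ-≡ _ k 2 (LargeResidues.largeResidueCount-half n (n !) n!²≡-1) ⟩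
  k                             ∎
  where
  open ≡-Reasoning
  n = k * 2
  p = suc (n + n)
  n!²≡-1 : p ∣ suc (n ! * n !)
  n!²≡-1 = halfFactorial-square n (divides k refl) isPrime
  half : ∀ m → (m + m) / 2 ≡ m
  half m = trans (cong (_/ 2) (ring m)) (m*n/n≡m m 2)
    where
    ring : ∀ m → m + m ≡ m * 2
    ring = solve-∀

≡1mod4⇒4k+1 : ∀ p → p % 4 ≡ 1 → p ≡ suc (p / 4 * 2 + p / 4 * 2)
≡1mod4⇒4k+1 p p%4≡1 = trans (m≡m%n+[m/n]*n p 4) (cong₂ _+_ p%4≡1 (ring (p / 4)))
  where
  ring : ∀ k → k * 4 ≡ k * 2 + k * 2
  ring = solve-∀

lemma3p3 : (p : ℕ) → .{{_ : NonZero p}} → Prime p → p % 4 ≡ 1 →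
    countLarge p ≡ (p ∸ 1) / 4
lemma3p3 p isPrime p%4≡1 with p / 4 | ≡1mod4⇒4k+1 p p%4≡1
... | k | refl = trans (countLarge-4k+1 k isPrime) (sym quarter)
  where
  quarter : (k * 2 + k * 2) / 4 ≡ k
  quarter = trans (cong (_/ 4) (ring k)) (m*n/n≡m k 4)
    where
    ring : ∀ k → k * 2 + k * 2 ≡ k * 4
    ring = solve-∀
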